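{- Let $I$ be an instance of \textsc{3-SAT*} with 1-in-3-clauses $C_0,\dots,C_{m-1}$, 2-in-3-clauses $C_m,\dots,C_{2m-1}$ and variables $x_0,\dots,x_{n-1}$, and let $\kappa:[n]\times[4]\to[2m]\times[3]$ be the bijection mapping $(j,t)$ to the (clause index, position in clause) of the first ($t=0$) or second ($t=1$) positive occurrence of $x_j$, or of the first ($t=2$) or second ($t=3$) negative occurrence of $x_j$. Construct the restricted assignment instance $I'$ with machines $\mathtt{TMach}(j,q)$ ($j\in[n]$, $q\in[2]$) and $\mathtt{CMach}(i,s)$ ($i\in[2m]$, $s\in[3]$), and jobs: for each $j\in[n]$ a job $\mathtt{TJob}(j)$ of size $2$ eligible on $\{\mathtt{TMach}(j,0),\mathtt{TMach}(j,1)\}$; for each $i\in[2m]$ and $s\in[3]$ a job $\mathtt{CJob}(i,s)$ eligible on $\{\mathtt{CMach}(i,s'):s'\in[3]\}$, where $\mathtt{CJob}(i,0)$ has size $1$, $\mathtt{CJob}(i,2)$ has size $2$, and $\mathtt{CJob}(i,1)$ has size $2$ if $C_i$ is a 1-in-3-clause and size $1$ otherwise; and for each $j\in[n]$, $t\in[4]$ a job $\mathtt{VJob}(j,t)$ of size $1$ eligible on $\{\mathtt{TMach}(j,\lfloor t/2\rfloor),\mathtt{CMach}(\kappa(j,t))\}$. Then there is a satisfying truth assignment for $I$ if and only if there is a schedule with makespan $2$ for $I'$.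
   Context: For an integer $k$, $[k]=\{0,\dots,k-1\}$. A \textsc{3-SAT*} instance is a conjunction of clauses, each with exactly 3 literals; each clause is either a 1-in-3-clause (satisfied iff exactly one of its literals is true) or a 2-in-3-clause (satisfied iff exactly two of its literals are true); there are equally many 1-in-3-clauses and 2-in-3-clauses, and each literal ($x_j$ and $\neg x_j$) occurs exactly twice. A satisfying truth assignment satisfies every clause. In a restricted assignment instance each job has a size and a set of eligible machines; a schedule assigns each job to an eligible machine and its makespan is the maximum over machines of the total size assigned to the machine. -}

module Defs where

open import Data.Nat using (ℕ; _+_; _*_; _<_; _≤_; _<?_)
open import Data.Bool using (Bool; true; false; not; if_then_else_)
open import Data.Fin using (Fin; toℕ; zero; suc)
import Data.Fin as F
import Data.Bool as B
open import Data.Product using (_×_; _,_; proj₁; proj₂; Σ)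
open import Data.Product.Properties using (≡-dec)
open import Data.Sum using (_⊎_)
open import Data.Empty using (⊥)
open import Data.List using (List; map; filter; length; allFin; cartesianProduct; _++_)
open import Data.Nat.ListAction using (sum)
open import Relation.Binary.PropositionalEquality using (_≡_; refl)
open import Relation.Binary.Definitions using (DecidableEquality)
open import Relation.Nullary using (yes; no; ⌊_⌋)

-- A literal over variables x_0..x_{n-1}: (j , true) is x_j, (j , false) is ¬x_j.
Literal : ℕ → Set
Literal n = Fin n × Bool

_≟L_ : ∀ {n} → DecidableEquality (Literal n)
_≟L_ = ≡-dec F._≟_ B._≟_

-- Clauses C_0..C_{2m-1}, each with exactly 3 literal positions.
-- C_i is a 1-in-3-clause iff i < m, and a 2-in-3-clause iff m ≤ i.
record Clauses (n m : ℕ) : Set where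
  constructor clauses
  field
    lit : Fin (m + m) → Fin 3 → Literal n
open Clauses public

record Position (m : ℕ) : Set where
  constructor ⟨_,_⟩
  field
    clauseIx : Fin (m + m)
    slot     : Fin 3
open Position public

positions : (m : ℕ) → List (Position m)
positions m = map (λ p → ⟨ proj₁ p , proj₂ p ⟩) (cartesianProduct (allFin (m + m)) (allFin 3))

occurrences : ∀ {n m} → Clauses n m → Literal n → ℕ
occurrences {n} {m} C ℓ =
  length (filter (λ p → lit C (clauseIx p) (slot p) ≟L ℓ) (positions m))

Is3SAT* : ∀ {n m} → Clauses n m → Set
Is3SAT* {n} C = (ℓ : Literal n) → occurrences C ℓ ≡ 2

isOneInThree : ∀ {m} → Fin (m + m) → Bool
isOneInThree {m} i = ⌊ toℕ i <? m ⌋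

litValue : ∀ {n} → (Fin n → Bool) → Literal n → Bool
litValue a (j , true) = a j
litValue a (j , false) = not (a j)

numTrue : ∀ {n m} → Clauses n m → (Fin n → Bool) → Fin (m + m) → ℕ
numTrue C a i = sum (map (λ s → if litValue a (lit C i s) then 1 else 0) (allFin 3))

Satisfies : ∀ {n m} → Clauses n m → (Fin n → Bool) → Set
Satisfies {n} {m} C a =
  (i : Fin (m + m)) → numTrue C a i ≡ (if isOneInThree {m} i then 1 else 2)

Satisfiable : ∀ {n m} → Clauses n m → Set
Satisfiable {n} C = Σ (Fin n → Bool) (Satisfies C)

signOf : Fin 4 → Bool
signOf zero = true
signOf (suc zero) = true
signOf (suc (suc _)) = false

half : Fin 4 → Fin 2
half zero = zero
half (suc zero) = zero
half (suc (suc zero)) = suc zero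
half (suc (suc (suc zero))) = suc zero

posIndex : ∀ {m} → Position m → ℕ
posIndex ⟨ i , s ⟩ = toℕ i * 3 + toℕ s

IsKappa : ∀ {n m} → Clauses n m → (Fin n → Fin 4 → Position m) → Set
IsKappa {n} C κ =
  ((j : Fin n) (t : Fin 4) → lit C (clauseIx (κ j t)) (slot (κ j t)) ≡ (j , signOf t))
  × ((j : Fin n) → posIndex (κ j zero) < posIndex (κ j (suc zero)))
  × ((j : Fin n) → posIndex (κ j (suc (suc zero))) < posIndex (κ j (suc (suc (suc zero)))))

record RAInstance : Set₁ where
  field
    Job      : Set
    Mach     : Set
    jobs     : List Job            -- enumeration of all jobs (each exactly once)
    size     : Job → ℕ
    Eligible : Job → Mach → Set
    _≟M_     : DecidableEquality Mach

record Schedule (I : RAInstance) : Set where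
  open RAInstance I
  field
    assign   : Job → Mach
    eligible : (J : Job) → Eligible J (assign J)

load : (I : RAInstance) → Schedule I → RAInstance.Mach I → ℕ
load I σ μ = sum (map size (filter (λ J → Schedule.assign σ J ≟M μ) jobs))
  where open RAInstance I

MakespanAtMost : (I : RAInstance) → Schedule I → ℕ → Set
MakespanAtMost I σ T = (μ : RAInstance.Mach I) → load I σ μ ≤ T

data Mach' (n m : ℕ) : Set where
  TMach : Fin n → Fin 2 → Mach' n m
  CMach : Fin (m + m) → Fin 3 → Mach' n m

data Job' (n m : ℕ) : Set where
  TJob : Fin n → Job' n m
  CJob : Fin (m + m) → Fin 3 → Job' n m
  VJob : Fin n → Fin 4 → Job' n m

_≟Mach'_ : ∀ {n m} → DecidableEquality (Mach' n m)
TMach j q ≟Mach' TMach j' q' with j F.≟ j' | q F.≟ q'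
... | yes refl | yes refl = yes refl
... | no ne | _ = no λ { refl → ne refl }
... | yes _ | no ne = no λ { refl → ne refl }
TMach _ _ ≟Mach' CMach _ _ = no λ ()
CMach _ _ ≟Mach' TMach _ _ = no λ ()
CMach i s ≟Mach' CMach i' s' with i F.≟ i' | s F.≟ s'
... | yes refl | yes refl = yes refl
... | no ne | _ = no λ { refl → ne refl }
... | yes _ | no ne = no λ { refl → ne refl }

allJobs' : (n m : ℕ) → List (Job' n m)
allJobs' n m =
  map TJob (allFin n)
  ++ map (λ p → CJob (proj₁ p) (proj₂ p)) (cartesianProduct (allFin (m + m)) (allFin 3))
  ++ map (λ p → VJob (proj₁ p) (proj₂ p)) (cartesianProduct (allFin n) (allFin 4))

size' : ∀ {n m} → Job' n m → ℕ
size' (TJob _) = 2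
size' (CJob _ zero) = 1
size' {m = m} (CJob i (suc zero)) = if isOneInThree {m} i then 2 else 1
size' (CJob _ (suc (suc _))) = 2
size' (VJob _ _) = 1

eligible' : ∀ {n m} → (Fin n → Fin 4 → Position m) → Job' n m → Mach' n m → Set
eligible' κ (TJob j) (TMach j' q) = j ≡ j'
eligible' κ (TJob j) (CMach _ _) = ⊥
eligible' κ (CJob i s) (TMach _ _) = ⊥
eligible' κ (CJob i s) (CMach i' s') = i ≡ i'
eligible' κ (VJob j t) μ =
  (μ ≡ TMach j (half t)) ⊎ (μ ≡ CMach (clauseIx (κ j t)) (slot (κ j t)))

reduction : (n m : ℕ) → (Fin n → Fin 4 → Position m) → RAInstance
reduction n m κ = record
  { Job = Job' n m
  ; Mach = Mach' n m
  ; jobs = allJobs' n m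
  ; size = size'
  ; Eligible = eligible' κ
  ; _≟M_ = _≟Mach'_
  }

module Submission where

-- A truth assignment is read off the placement of the truth jobs: x_j is true iff TJob(j)
-- sits on TMach(j,0).  In a schedule of makespan 2 the job VJob(j,t) of a true literal
-- cannot share TMach(j,⌊t/2⌋) with TJob(j), so it sits on its clause machine.  The clause
-- jobs of C_i have total size 5 (1-in-3) or 4 (2-in-3) and its three machines room for 6,
-- so C_i has at most 1 resp. 2 true literals.  Every variable gives exactly 2 true
-- occurrences, and double counting the 6m = 4n literal positions shows 2n = 3m, the sum of
-- these bounds; hence every bound is attained.  Conversely, a satisfying assignment sends
-- the VJobs of false literals to the truth machine not holding TJob(j), those of true
-- literals to their clauses, and the clause jobs can be arranged to fill each clause
-- machine exactly.

open import Defs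
open import Data.Nat using (ℕ)
open import Data.Fin using (Fin)
open import Data.Product using (Σ)
open import Function.Bundles using (_⇔_; mk⇔)

open import Data.Nat using (zero; suc; _+_; _*_; _≤_; _<_; z≤n; s≤s; _<?_)
open import Data.Nat.Properties
open import Data.Nat.ListAction using () renaming (sum to sumˡ)
open import Data.Nat.ListAction.Properties using (sum-++)
open import Data.Nat.Tactic.RingSolver using (solve-∀)
open import Data.Fin using (toℕ; _↑ˡ_; _↑ʳ_; punchIn) renaming (zero to fzero; suc to fsuc)
open import Data.Fin.Patterns using (0F; 1F; 2F; 3F)
open import Data.Fin.Properties using (punchInᵢ≢i; toℕ-↑ˡ; toℕ-↑ʳ; toℕ<n) renaming (_≟_ to _≟ᶠ_)
open import Data.Fin.Permutation.Components using (transpose)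
open import Data.Bool using (Bool; true; false; not; if_then_else_)
open import Data.Bool.Properties using () renaming (_≟_ to _≟ᵇ_)
open import Data.Product using (_×_; _,_; proj₁; proj₂; uncurry)
open import Data.Product.Properties using (≡-dec)
open import Data.Sum using (inj₁; inj₂)
open import Data.Empty using (⊥; ⊥-elim)
open import Data.List using (List; []; _∷_; map; filter; length; allFin; tabulate; cartesianProduct; _++_)
open import Data.List.Properties using (map-tabulate; map-∘; map-++)
open import Data.Vec.Functional using (Vector) renaming ([] to []ᵛ; _∷_ to _∷ᵛ_)
open import Function using (_∘_; id)
open import Relation.Binary.Definitions using (DecidableEquality)
open import Relation.Binary.PropositionalEquality
open import Relation.Nullary using (Dec; yes; no; ¬_; does)
open import Relation.Nullary.Decidable using (dec-true; dec-false; isYes≗does)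
open import Algebra.Properties.CommutativeMonoid.Sum +-0-commutativeMonoid
  using (sum-syntax; ∑-comm; ∑-distrib-+; sum-cong-≗; sum-remove; sum-replicate-zero)
  renaming (sum to ∑)

-- Indicator sums over finite index sets

𝟙 : {A : Set} → Dec A → ℕ → ℕ
𝟙 (yes _) c = c
𝟙 (no _)  c = 0

𝟙-yes : {A : Set} (d : Dec A) {c : ℕ} → A → 𝟙 d c ≡ c
𝟙-yes (yes _) a = refl
𝟙-yes (no ¬a) a = ⊥-elim (¬a a)

𝟙-no : {A : Set} (d : Dec A) {c : ℕ} → ¬ A → 𝟙 d c ≡ 0
𝟙-no (yes a) ¬a = ⊥-elim (¬a a)
𝟙-no (no _)  ¬a = refl

𝟙-≤ : {A : Set} (d : Dec A) {c : ℕ} → 𝟙 d c ≤ c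
𝟙-≤ (yes _) = ≤-refl
𝟙-≤ (no _)  = z≤n

𝟙-cong : {A B : Set} (d : Dec A) (e : Dec B) {c : ℕ} → (A → B) → (B → A) → 𝟙 d c ≡ 𝟙 e c
𝟙-cong (yes a) e A→B B→A = sym (𝟙-yes e (A→B a))
𝟙-cong (no ¬a) e A→B B→A = sym (𝟙-no e (¬a ∘ B→A))

∑-const : ∀ k c → ∑[ _ < k ] c ≡ k * c
∑-const zero    c = refl
∑-const (suc k) c = cong (c +_) (∑-const k c)

∑-mono-≤ : ∀ {k} {f g : Fin k → ℕ} → (∀ i → f i ≤ g i) → ∑ f ≤ ∑ g
∑-mono-≤ {zero}  f≤g = z≤n
∑-mono-≤ {suc k} f≤g = +-mono-≤ (f≤g fzero) (∑-mono-≤ (f≤g ∘ fsuc))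

∑-≥ : ∀ {k} (f : Fin k → ℕ) i → f i ≤ ∑ f
∑-≥ {suc k} f i = ≤-trans (m≤m+n (f i) _) (≤-reflexive (sym (sum-remove {i = i} f)))

∑-single : ∀ {k} (f : Fin k → ℕ) i → (∀ j → j ≢ i → f j ≡ 0) → ∑ f ≡ f i
∑-single {suc k} f i f≡0 = begin
  ∑ f                           ≡⟨ sum-remove {i = i} f ⟩
  f i + ∑[ j < k ] f (punchIn i j) ≡⟨ cong (f i +_) (sum-cong-≗ (λ j → f≡0 _ (punchInᵢ≢i i j))) ⟩
  f i + ∑[ _ < k ] 0           ≡⟨ cong (f i +_) (sum-replicate-zero k) ⟩
  f i + 0                       ≡⟨ +-identityʳ (f i) ⟩
  f i                           ∎
  where open ≡-Reasoning

∑-↑ : ∀ a b (f : Fin (a + b) → ℕ) → ∑ f ≡ ∑[ i < a ] f (i ↑ˡ b) + ∑[ i < b ] f (a ↑ʳ i)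
∑-↑ zero    b f = refl
∑-↑ (suc a) b f = trans (cong (f fzero +_) (∑-↑ a b (f ∘ fsuc))) (sym (+-assoc (f fzero) _ _))

∑-≤-≡⇒≗ : ∀ {k} {f g : Fin k → ℕ} → (∀ i → f i ≤ g i) → ∑ f ≡ ∑ g → ∀ i → f i ≡ g i
∑-≤-≡⇒≗ {suc k} {f} {g} f≤g ∑≡ = λ where
    fzero    → head≡
    (fsuc i) → ∑-≤-≡⇒≗ (f≤g ∘ fsuc) tail≡ i
  where
  head≡ : f fzero ≡ g fzero
  head≡ = ≤-antisym (f≤g fzero)
    (+-cancelʳ-≤ _ _ _ (≤-trans (≤-reflexive (sym ∑≡)) (+-monoʳ-≤ (f fzero) (∑-mono-≤ (f≤g ∘ fsuc)))))
  tail≡ : ∑[ i < k ] f (fsuc i) ≡ ∑[ i < k ] g (fsuc i)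
  tail≡ = +-cancelˡ-≡ (f fzero) _ _ (trans ∑≡ (cong (_+ _) (sym head≡)))

_≟₂_ : ∀ {a b} → DecidableEquality (Fin a × Fin b)
_≟₂_ = ≡-dec _≟ᶠ_ _≟ᶠ_

∑₂ : ∀ {a b} → (Fin a × Fin b → ℕ) → ℕ
∑₂ {a} {b} g = ∑[ i < a ] ∑[ s < b ] g (i , s)

module _ {a b : ℕ} where

  ∑₂-cong : {f g : Fin a × Fin b → ℕ} → (∀ p → f p ≡ g p) → ∑₂ f ≡ ∑₂ g
  ∑₂-cong f≗g = sum-cong-≗ (λ i → sum-cong-≗ (λ s → f≗g (i , s)))

  ∑₂-mono-≤ : {f g : Fin a × Fin b → ℕ} → (∀ p → f p ≤ g p) → ∑₂ f ≤ ∑₂ g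
  ∑₂-mono-≤ f≤g = ∑-mono-≤ (λ i → ∑-mono-≤ (λ s → f≤g (i , s)))

  ∑₂-const : ∀ c → ∑₂ {a} {b} (λ _ → c) ≡ a * (b * c)
  ∑₂-const c = trans (sum-cong-≗ {a} (λ _ → ∑-const b c)) (∑-const a (b * c))

  ∑₂-distrib-+ : (f g : Fin a × Fin b → ℕ) → ∑₂ (λ p → f p + g p) ≡ ∑₂ f + ∑₂ g
  ∑₂-distrib-+ f g =
    trans (sum-cong-≗ (λ i → ∑-distrib-+ (λ s → f (i , s)) (λ s → g (i , s)))) (∑-distrib-+ {a} _ _)

  ∑₂-≥ : (g : Fin a × Fin b → ℕ) (p : Fin a × Fin b) → g p ≤ ∑₂ g
  ∑₂-≥ g (i , s) = ≤-trans (∑-≥ (λ s → g (i , s)) s) (∑-≥ (λ i → ∑[ s < b ] g (i , s)) i)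

  ∑₂-row : (g : Fin a × Fin b → ℕ) (x : Fin a) → (∀ i s → i ≢ x → g (i , s) ≡ 0) →
           ∑₂ g ≡ ∑[ s < b ] g (x , s)
  ∑₂-row g x g≡0 = ∑-single _ x (λ i i≢x →
    trans (sum-cong-≗ (λ s → g≡0 i s i≢x)) (sum-replicate-zero b))

  ∑₂-single : (g : Fin a × Fin b → ℕ) (q : Fin a × Fin b) → (∀ p → p ≢ q → g p ≡ 0) → ∑₂ g ≡ g q
  ∑₂-single g (x , y) g≡0 =
    trans (∑₂-row g x (λ i s i≢x → g≡0 (i , s) (i≢x ∘ cong proj₁)))
          (∑-single _ y (λ s s≢y → g≡0 (x , s) (s≢y ∘ cong proj₂)))

  ∑₂-≥-three : (g : Fin a × Fin b → ℕ) {p q r : Fin a × Fin b} → p ≢ q → p ≢ r → q ≢ r →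
               g p + g q + g r ≤ ∑₂ g
  ∑₂-≥-three g {p} {q} {r} p≢q p≢r q≢r = begin
    g p + g q + g r                      ≡⟨ cong₂ _+_ (cong₂ _+_ (at p) (at q)) (at r) ⟨
    ∑₂ (δ p) + ∑₂ (δ q) + ∑₂ (δ r)       ≡⟨ cong (_+ ∑₂ (δ r)) (∑₂-distrib-+ (δ p) (δ q)) ⟨
    ∑₂ (λ x → δ p x + δ q x) + ∑₂ (δ r)  ≡⟨ ∑₂-distrib-+ _ (δ r) ⟨
    ∑₂ (λ x → δ p x + δ q x + δ r x)     ≤⟨ ∑₂-mono-≤ pointwise ⟩
    ∑₂ g                                 ∎
    where
    open ≤-Reasoning
    δ : Fin a × Fin b → Fin a × Fin b → ℕ
    δ y x = 𝟙 (x ≟₂ y) (g x)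
    at : ∀ y → ∑₂ (δ y) ≡ g y
    at y = trans (∑₂-single (δ y) y (λ x x≢y → 𝟙-no (x ≟₂ y) x≢y)) (𝟙-yes (y ≟₂ y) refl)
    pointwise : ∀ x → δ p x + δ q x + δ r x ≤ g x
    pointwise x with x ≟₂ p | x ≟₂ q | x ≟₂ r
    ... | yes refl | yes refl | _        = ⊥-elim (p≢q refl)
    ... | yes refl | _        | yes refl = ⊥-elim (p≢r refl)
    ... | _        | yes refl | yes refl = ⊥-elim (q≢r refl)
    ... | yes _    | no _     | no _     = ≤-reflexive (trans (+-identityʳ _) (+-identityʳ _))
    ... | no _     | yes _    | no _     = ≤-reflexive (+-identityʳ _)
    ... | no _     | no _     | yes _    = ≤-refl
    ... | no _     | no _     | no _     = z≤n

∑₂-comm : ∀ {a b c d} (h : Fin a × Fin b → Fin c × Fin d → ℕ) →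
          ∑₂ (λ p → ∑₂ (h p)) ≡ ∑₂ (λ q → ∑₂ (λ p → h p q))
∑₂-comm h =
  trans (sum-cong-≗ (λ i → ∑-comm (λ s j → ∑[ t < _ ] h (i , s) (j , t))))
  (trans (∑-comm (λ i j → ∑[ s < _ ] ∑[ t < _ ] h (i , s) (j , t)))
  (trans (sum-cong-≗ (λ j → sum-cong-≗ (λ i → ∑-comm (λ s t → h (i , s) (j , t)))))
         (sum-cong-≗ (λ j → ∑-comm (λ i t → ∑[ s < _ ] h (i , s) (j , t))))))

∑₂-reindex : ∀ {a b c d} (f : Fin a × Fin b → Fin c × Fin d) →
             (∀ {p p'} → f p ≡ f p' → p ≡ p') → (∀ q → Σ (Fin a × Fin b) λ p → f p ≡ q) →
             (w : Fin c × Fin d → ℕ) → ∑₂ w ≡ ∑₂ (w ∘ f)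
∑₂-reindex f f-injective f-surjective w = begin
  ∑₂ w                                   ≡⟨ ∑₂-cong fibre ⟨
  ∑₂ (λ q → ∑₂ (λ p → 𝟙 (f p ≟₂ q) (w q))) ≡⟨ ∑₂-comm (λ q p → 𝟙 (f p ≟₂ q) (w q)) ⟩
  ∑₂ (λ p → ∑₂ (λ q → 𝟙 (f p ≟₂ q) (w q))) ≡⟨ ∑₂-cong image ⟩
  ∑₂ (w ∘ f)                             ∎
  where
  open ≡-Reasoning
  fibre : ∀ q → ∑₂ (λ p → 𝟙 (f p ≟₂ q) (w q)) ≡ w q
  fibre q with f-surjective q
  ... | p₀ , fp₀≡q = trans
    (∑₂-single _ p₀ λ p p≢p₀ → 𝟙-no (f p ≟₂ q) λ fp≡q → p≢p₀ (f-injective (trans fp≡q (sym fp₀≡q))))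
    (𝟙-yes (f p₀ ≟₂ q) fp₀≡q)
  image : ∀ p → ∑₂ (λ q → 𝟙 (f p ≟₂ q) (w q)) ≡ w (f p)
  image p = trans (∑₂-single _ (f p) (λ q q≢fp → 𝟙-no (f p ≟₂ q) (q≢fp ∘ sym))) (𝟙-yes (f p ≟₂ f p) refl)

sum-tabulate : ∀ {k} (f : Fin k → ℕ) → sumˡ (tabulate f) ≡ ∑ f
sum-tabulate {zero}  f = refl
sum-tabulate {suc k} f = cong (f fzero +_) (sum-tabulate (f ∘ fsuc))

sum-map-allFin : ∀ {k} (f : Fin k → ℕ) → sumˡ (map f (allFin k)) ≡ ∑ f
sum-map-allFin f = trans (cong sumˡ (map-tabulate id f)) (sum-tabulate f)

sum-map-∘ : ∀ {A B : Set} (g : B → ℕ) (f : A → B) xs → sumˡ (map g (map f xs)) ≡ sumˡ (map (g ∘ f) xs)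
sum-map-∘ g f xs = cong sumˡ (sym (map-∘ xs))

sum-map-++ : ∀ {A : Set} (g : A → ℕ) xs ys → sumˡ (map g (xs ++ ys)) ≡ sumˡ (map g xs) + sumˡ (map g ys)
sum-map-++ g xs ys = trans (cong sumˡ (map-++ g xs ys)) (sum-++ (map g xs) _)

sum-map-cartesianProduct : ∀ {A B : Set} (g : A × B → ℕ) xs ys →
  sumˡ (map g (cartesianProduct xs ys)) ≡ sumˡ (map (λ x → sumˡ (map (λ y → g (x , y)) ys)) xs)
sum-map-cartesianProduct g []       ys = refl
sum-map-cartesianProduct g (x ∷ xs) ys =
  trans (sum-map-++ g (map (x ,_) ys) _) (cong₂ _+_ (sum-map-∘ g (x ,_) ys) (sum-map-cartesianProduct g xs ys))

allPairs : ∀ a b → List (Fin a × Fin b)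
allPairs a b = cartesianProduct (allFin a) (allFin b)

sum-map-allPairs : ∀ {a b} (g : Fin a × Fin b → ℕ) → sumˡ (map g (allPairs a b)) ≡ ∑₂ g
sum-map-allPairs {a} {b} g = trans (sum-map-cartesianProduct g (allFin a) (allFin b))
  (trans (sum-map-allFin (λ i → sumˡ (map (λ s → g (i , s)) (allFin b))))
         (sum-cong-≗ {a} (λ i → sum-map-allFin (λ s → g (i , s)))))

sum-map-filter : ∀ {A : Set} {P : A → Set} (P? : ∀ x → Dec (P x)) (g : A → ℕ) xs →
  sumˡ (map g (filter P? xs)) ≡ sumˡ (map (λ x → 𝟙 (P? x) (g x)) xs)
sum-map-filter P? g [] = refl
sum-map-filter P? g (x ∷ xs) with P? x
... | yes _ = cong (g x +_) (sum-map-filter P? g xs)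
... | no _  = sum-map-filter P? g xs

length-filter : ∀ {A : Set} {P : A → Set} (P? : ∀ x → Dec (P x)) xs →
  length (filter P? xs) ≡ sumˡ (map (λ x → 𝟙 (P? x) 1) xs)
length-filter P? [] = refl
length-filter P? (x ∷ xs) with P? x
... | yes _ = cong suc (length-filter P? xs)
... | no _  = length-filter P? xs

-- The variable and clause gadgets

bit : Bool → ℕ
bit b = if b then 1 else 0

literalHolds : Bool → Bool → Bool
literalHolds b true  = b
literalHolds b false = not b

litValue-literalHolds : ∀ {n} (a : Fin n → Bool) j s → litValue a (j , s) ≡ literalHolds (a j) s
litValue-literalHolds a j true  = refl
litValue-literalHolds a j false = refl

two-true-per-variable : ∀ b → ∑[ t < 4 ] bit (literalHolds b (signOf t)) ≡ 2
two-true-per-variable true  = refl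
two-true-per-variable false = refl

side : Bool → Fin 2
side true  = 0F
side false = 1F

variable-load : ∀ b q →
  𝟙 (side b ≟ᶠ q) 2 + (0 + ∑[ t < 4 ] (if literalHolds b (signOf t) then 0 else 𝟙 (half t ≟ᶠ q) 1)) ≡ 2
variable-load true  0F = refl
variable-load true  1F = refl
variable-load false 0F = refl
variable-load false 1F = refl

holds⇒side≡half : ∀ q t → literalHolds (does (q ≟ᶠ 0F)) (signOf t) ≡ true → q ≡ half t
holds⇒side≡half 0F 0F _ = refl
holds⇒side≡half 0F 1F _ = refl
holds⇒side≡half 1F 2F _ = refl
holds⇒side≡half 1F 3F _ = refl
holds⇒side≡half 0F 2F ()
holds⇒side≡half 0F 3F ()
holds⇒side≡half 1F 0F ()
holds⇒side≡half 1F 1F ()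

clauseTarget : Bool → ℕ
clauseTarget b = if b then 1 else 2

cjobSize : Bool → Fin 3 → ℕ
cjobSize b 0F = 1
cjobSize b 1F = if b then 2 else 1
cjobSize b 2F = 2

capacity-left : ∀ b x → ∑[ s < 3 ] cjobSize b s + x ≤ 6 → x ≤ clauseTarget b
capacity-left true  x (s≤s (s≤s (s≤s (s≤s (s≤s x≤1))))) = x≤1
capacity-left false x (s≤s (s≤s (s≤s (s≤s x≤2))))       = x≤2

-- The odd slot of a satisfied clause carries its only true (1-in-3) or only false (2-in-3)
-- literal; transposing the odd clause job onto it fills all three clause machines exactly.
oddSlot : Bool → Vector Bool 3 → Fin 3
oddSlot b v with does (v 0F ≟ᵇ b) | does (v 1F ≟ᵇ b)
... | true  | _     = 0F
... | false | true  = 1F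
... | false | false = 2F

oddJob : Bool → Fin 3
oddJob b = if b then 0F else 2F

cjobSlot : Bool → Vector Bool 3 → Fin 3 → Fin 3
cjobSlot b v = transpose (oddJob b) (oddSlot b v)

clause-load : ∀ b v₀ v₁ v₂ → let v = v₀ ∷ᵛ v₁ ∷ᵛ v₂ ∷ᵛ []ᵛ in
  ∑[ s < 3 ] bit (v s) ≡ clauseTarget b →
  ∀ s' → ∑[ s < 3 ] 𝟙 (cjobSlot b v s ≟ᶠ s') (cjobSize b s) + bit (v s') ≡ 2
clause-load true  true  false false _ = λ { 0F → refl ; 1F → refl ; 2F → refl }
clause-load true  false true  false _ = λ { 0F → refl ; 1F → refl ; 2F → refl }
clause-load true  false false true  _ = λ { 0F → refl ; 1F → refl ; 2F → refl }
clause-load false false true  true  _ = λ { 0F → refl ; 1F → refl ; 2F → refl }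
clause-load false true  false true  _ = λ { 0F → refl ; 1F → refl ; 2F → refl }
clause-load false true  true  false _ = λ { 0F → refl ; 1F → refl ; 2F → refl }
clause-load true  true  true  _     ()
clause-load true  true  false true  ()
clause-load true  false true  true  ()
clause-load true  false false false ()
clause-load false true  true  true  ()
clause-load false true  false false ()
clause-load false false false false ()
clause-load false false true  false ()

-- Correctness of the reduction

module Reduction (n m : ℕ) (C : Clauses n m) (is3 : Is3SAT* C)
                 (κ : Fin n → Fin 4 → Position m) (isK : IsKappa C κ) where

  I : RAInstance
  I = reduction n m κ

  litAt : Fin (m + m) × Fin 3 → Literal n
  litAt (i , s) = lit C i s

  toPosition : Fin (m + m) × Fin 3 → Position m
  toPosition (i , s) = ⟨ i , s ⟩

  κ̂ : Fin n × Fin 4 → Fin (m + m) × Fin 3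
  κ̂ (j , t) = clauseIx (κ j t) , slot (κ j t)

  κ̂-lit : ∀ j t → litAt (κ̂ (j , t)) ≡ (j , signOf t)
  κ̂-lit = proj₁ isK

  κ̂-0≢1 : ∀ j → κ̂ (j , 0F) ≢ κ̂ (j , 1F)
  κ̂-0≢1 j e = <-irrefl (cong (posIndex ∘ toPosition) e) (proj₁ (proj₂ isK) j)

  κ̂-2≢3 : ∀ j → κ̂ (j , 2F) ≢ κ̂ (j , 3F)
  κ̂-2≢3 j e = <-irrefl (cong (posIndex ∘ toPosition) e) (proj₂ (proj₂ isK) j)

  κ̂-index-injective : ∀ {j} t t' → signOf t ≡ signOf t' → κ̂ (j , t) ≡ κ̂ (j , t') → t ≡ t'
  κ̂-index-injective 0F 0F _ _ = refl
  κ̂-index-injective 1F 1F _ _ = refl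
  κ̂-index-injective 2F 2F _ _ = refl
  κ̂-index-injective 3F 3F _ _ = refl
  κ̂-index-injective {j} 0F 1F _ e = ⊥-elim (κ̂-0≢1 j e)
  κ̂-index-injective {j} 1F 0F _ e = ⊥-elim (κ̂-0≢1 j (sym e))
  κ̂-index-injective {j} 2F 3F _ e = ⊥-elim (κ̂-2≢3 j e)
  κ̂-index-injective {j} 3F 2F _ e = ⊥-elim (κ̂-2≢3 j (sym e))
  κ̂-index-injective 0F (fsuc (fsuc _)) () _
  κ̂-index-injective 1F (fsuc (fsuc _)) () _
  κ̂-index-injective (fsuc (fsuc _)) 0F () _
  κ̂-index-injective (fsuc (fsuc _)) 1F () _

  κ̂-≡⇒literal-≡ : ∀ {j t j' t'} → κ̂ (j , t) ≡ κ̂ (j' , t') → (j , signOf t) ≡ (j' , signOf t')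
  κ̂-≡⇒literal-≡ {j} {t} {j'} {t'} e = trans (sym (κ̂-lit j t)) (trans (cong litAt e) (κ̂-lit j' t'))

  κ̂-injective : ∀ {p p'} → κ̂ p ≡ κ̂ p' → p ≡ p'
  κ̂-injective {j , t} {j' , t'} e with cong proj₁ (κ̂-≡⇒literal-≡ e)
  ... | refl = cong (j ,_) (κ̂-index-injective t t' (cong proj₂ (κ̂-≡⇒literal-≡ e)) e)

  occurrences-≡-∑₂ : ∀ ℓ → occurrences C ℓ ≡ ∑₂ (λ p → 𝟙 (litAt p ≟L ℓ) 1)
  occurrences-≡-∑₂ ℓ = trans (length-filter _ (positions m))
    (trans (sum-map-∘ (λ p → 𝟙 (lit C (clauseIx p) (slot p) ≟L ℓ) 1) toPosition (allPairs (m + m) 3))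
           (sum-map-allPairs {m + m} {3} (λ p → 𝟙 (litAt p ≟L ℓ) 1)))

  no-third-occurrence : ∀ {p p' q} → p ≢ p' → p ≢ q → p' ≢ q →
                        litAt p ≡ litAt q → litAt p' ≡ litAt q → ⊥
  no-third-occurrence {p} {p'} {q} p≢p' p≢q p'≢q ℓp ℓp' = <-irrefl refl (begin
    3                        ≡⟨ cong₂ _+_ (cong₂ _+_ (occurs ℓp) (occurs ℓp')) (occurs refl) ⟨
    g p + g p' + g q         ≤⟨ ∑₂-≥-three g p≢p' p≢q p'≢q ⟩
    ∑₂ g                     ≡⟨ occurrences-≡-∑₂ (litAt q) ⟨
    occurrences C (litAt q)  ≡⟨ is3 (litAt q) ⟩
    2                        ∎)
    where
    open ≤-Reasoning
    g : Fin (m + m) × Fin 3 → ℕ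
    g r = 𝟙 (litAt r ≟L litAt q) 1
    occurs : ∀ {r} → litAt r ≡ litAt q → g r ≡ 1
    occurs {r} = 𝟙-yes (litAt r ≟L litAt q)

  one-of-two-occurrences : ∀ p p' q → κ̂ p ≢ κ̂ p' → litAt (κ̂ p) ≡ litAt q → litAt (κ̂ p') ≡ litAt q →
                           Σ (Fin n × Fin 4) λ r → κ̂ r ≡ q
  one-of-two-occurrences p p' q p≢p' ℓp ℓp' with κ̂ p ≟₂ q | κ̂ p' ≟₂ q
  ... | yes e  | _       = p , e
  ... | no _   | yes e   = p' , e
  ... | no p≢q | no p'≢q = ⊥-elim (no-third-occurrence p≢p' p≢q p'≢q ℓp ℓp')

  κ̂-surjective : ∀ q → Σ (Fin n × Fin 4) λ p → κ̂ p ≡ q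
  κ̂-surjective q with litAt q in ℓ≡
  ... | j , true  = one-of-two-occurrences (j , 0F) (j , 1F) q (κ̂-0≢1 j)
                      (trans (κ̂-lit j 0F) (sym ℓ≡)) (trans (κ̂-lit j 1F) (sym ℓ≡))
  ... | j , false = one-of-two-occurrences (j , 2F) (j , 3F) q (κ̂-2≢3 j)
                      (trans (κ̂-lit j 2F) (sym ℓ≡)) (trans (κ̂-lit j 3F) (sym ℓ≡))

  ∑₂-κ̂ : (w : Fin (m + m) × Fin 3 → ℕ) → ∑₂ w ≡ ∑₂ (w ∘ κ̂)
  ∑₂-κ̂ = ∑₂-reindex κ̂ κ̂-injective κ̂-surjective

  clause-count : m * 3 ≡ n * 2
  clause-count = *-cancelʳ-≡ (m * 3) (n * 2) 2 (begin
    m * 3 * 2                              ≡⟨ x*3*2≡[x+x]*3 m ⟩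
    (m + m) * 3                            ≡⟨ ∑₂-const {m + m} {3} 1 ⟨
    ∑₂ {m + m} {3} (λ _ → 1)               ≡⟨ ∑₂-κ̂ (λ _ → 1) ⟩
    ∑₂ {n} {4} (λ _ → 1)                   ≡⟨ ∑₂-const {n} {4} 1 ⟩
    n * 4                                  ≡⟨ x*4≡x*2*2 n ⟩
    n * 2 * 2                              ∎)
    where
    open ≡-Reasoning
    x*3*2≡[x+x]*3 : ∀ x → x * 3 * 2 ≡ (x + x) * 3
    x*3*2≡[x+x]*3 = solve-∀
    x*4≡x*2*2 : ∀ x → x * 4 ≡ x * 2 * 2
    x*4≡x*2*2 = solve-∀

  target : Fin (m + m) → ℕ
  target i = clauseTarget (isOneInThree {m} i)

  ∑-target : ∑ target ≡ m * 3
  ∑-target = begin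
    ∑ target                                       ≡⟨ ∑-↑ m m target ⟩
    ∑[ i < m ] target (i ↑ˡ m) + ∑[ i < m ] target (m ↑ʳ i)
      ≡⟨ cong₂ _+_ (sum-cong-≗ (cong clauseTarget ∘ one-in-three)) (sum-cong-≗ (cong clauseTarget ∘ two-in-three)) ⟩
    ∑[ _ < m ] 1 + ∑[ _ < m ] 2                    ≡⟨ cong₂ _+_ (∑-const m 1) (∑-const m 2) ⟩
    m * 1 + m * 2                                  ≡⟨ x*1+x*2≡x*3 m ⟩
    m * 3                                          ∎
    where
    open ≡-Reasoning
    one-in-three : ∀ i → isOneInThree {m} (i ↑ˡ m) ≡ true
    one-in-three i = trans (isYes≗does (toℕ (i ↑ˡ m) <? m))
      (dec-true (toℕ (i ↑ˡ m) <? m) (subst (_< m) (sym (toℕ-↑ˡ i m)) (toℕ<n i)))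
    two-in-three : ∀ i → isOneInThree {m} (m ↑ʳ i) ≡ false
    two-in-three i = trans (isYes≗does (toℕ (m ↑ʳ i) <? m))
      (dec-false (toℕ (m ↑ʳ i) <? m) λ lt →
        <-irrefl refl (≤-<-trans (m≤m+n m (toℕ i)) (subst (_< m) (toℕ-↑ʳ m i) lt)))
    x*1+x*2≡x*3 : ∀ x → x * 1 + x * 2 ≡ x * 3
    x*1+x*2≡x*3 = solve-∀

  true-count : ∀ a → ∑ (numTrue C a) ≡ n * 2
  true-count a = begin
    ∑₂ (bit ∘ litValue a ∘ litAt)
      ≡⟨ ∑₂-κ̂ (bit ∘ litValue a ∘ litAt) ⟩
    ∑₂ (bit ∘ litValue a ∘ litAt ∘ κ̂)
      ≡⟨ ∑₂-cong (λ (j , t) → cong (bit ∘ litValue a) (κ̂-lit j t)) ⟩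
    ∑[ j < n ] ∑[ t < 4 ] bit (litValue a (j , signOf t))
      ≡⟨ sum-cong-≗ (two-true-per-variable ∘ a) ⟩
    ∑[ _ < n ] 2
      ≡⟨ ∑-const n 2 ⟩
    n * 2
      ∎
    where open ≡-Reasoning

  contribution : (Job' n m → Mach' n m) → Mach' n m → Job' n m → ℕ
  contribution α μ J = 𝟙 (α J ≟Mach' μ) (size' J)

  loadᵀ loadᶜ loadⱽ : (Job' n m → Mach' n m) → Mach' n m → ℕ
  loadᵀ α μ = ∑[ j < n ] contribution α μ (TJob j)
  loadᶜ α μ = ∑₂ (contribution α μ ∘ uncurry CJob)
  loadⱽ α μ = ∑₂ (contribution α μ ∘ uncurry VJob)

  load-split : ∀ σ μ → let α = Schedule.assign σ in load I σ μ ≡ loadᵀ α μ + (loadᶜ α μ + loadⱽ α μ)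
  load-split σ μ = begin
    sumˡ (map size' (filter (λ J → α J ≟Mach' μ) (Ts ++ Cs ++ Vs)))    ≡⟨ sum-map-filter _ size' (Ts ++ Cs ++ Vs) ⟩
    sumˡ (map g (Ts ++ Cs ++ Vs))                                      ≡⟨ sum-map-++ g Ts (Cs ++ Vs) ⟩
    sumˡ (map g Ts) + sumˡ (map g (Cs ++ Vs))                          ≡⟨ cong (sumˡ (map g Ts) +_) (sum-map-++ g Cs Vs) ⟩
    sumˡ (map g Ts) + (sumˡ (map g Cs) + sumˡ (map g Vs))
      ≡⟨ cong₂ _+_ (trans (sum-map-∘ g TJob (allFin n)) (sum-map-allFin (g ∘ TJob)))
                   (cong₂ _+_ (trans (sum-map-∘ g (uncurry CJob) (allPairs (m + m) 3)) (sum-map-allPairs (g ∘ uncurry CJob)))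
                              (trans (sum-map-∘ g (uncurry VJob) (allPairs n 4)) (sum-map-allPairs (g ∘ uncurry VJob)))) ⟩
    loadᵀ α μ + (loadᶜ α μ + loadⱽ α μ)                                ∎
    where
    open ≡-Reasoning
    α = Schedule.assign σ
    g = contribution α μ
    Ts = map TJob (allFin n)
    Cs = map (uncurry CJob) (allPairs (m + m) 3)
    Vs = map (uncurry VJob) (allPairs n 4)

  loadᵀ+loadⱽ≤load : ∀ σ μ → let α = Schedule.assign σ in loadᵀ α μ + loadⱽ α μ ≤ load I σ μ
  loadᵀ+loadⱽ≤load σ μ =
    ≤-trans (+-monoʳ-≤ (loadᵀ α μ) (m≤n+m (loadⱽ α μ) (loadᶜ α μ))) (≤-reflexive (sym (load-split σ μ)))
    where α = Schedule.assign σ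

  loadᶜ+loadⱽ≤load : ∀ σ μ → let α = Schedule.assign σ in loadᶜ α μ + loadⱽ α μ ≤ load I σ μ
  loadᶜ+loadⱽ≤load σ μ = ≤-trans (m≤n+m _ (loadᵀ α μ)) (≤-reflexive (sym (load-split σ μ)))
    where α = Schedule.assign σ

  𝟙-TMach : ∀ j x y {c} → 𝟙 (TMach {n} {m} j x ≟Mach' TMach j y) c ≡ 𝟙 (x ≟ᶠ y) c
  𝟙-TMach j x y = 𝟙-cong (TMach j x ≟Mach' TMach j y) (x ≟ᶠ y) (λ { refl → refl }) (cong (TMach j))

  𝟙-CMach : ∀ i x y {c} → 𝟙 (CMach {n} {m} i x ≟Mach' CMach i y) c ≡ 𝟙 (x ≟ᶠ y) c
  𝟙-CMach i x y = 𝟙-cong (CMach i x ≟Mach' CMach i y) (x ≟ᶠ y) (λ { refl → refl }) (cong (CMach i))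

  clauseMachine : Fin n → Fin 4 → Mach' n m
  clauseMachine j t = uncurry CMach (κ̂ (j , t))

  vjobMachine : Bool → Fin n → Fin 4 → Mach' n m
  vjobMachine true  j t = clauseMachine j t
  vjobMachine false j t = TMach j (half t)

  size'-CJob : ∀ i s → size' {n} {m} (CJob i s) ≡ cjobSize (isOneInThree {m} i) s
  size'-CJob i 0F = refl
  size'-CJob i 1F = refl
  size'-CJob i 2F = refl

  module FromAssignment (a : Fin n → Bool) (sat : Satisfies C a) where

    -- An explicit vector, so that clause-load applies by computation.
    truth : Fin (m + m) → Vector Bool 3
    truth i = litValue a (lit C i 0F) ∷ᵛ litValue a (lit C i 1F) ∷ᵛ litValue a (lit C i 2F) ∷ᵛ []ᵛ

    litAt-truth : ∀ i s → litValue a (litAt (i , s)) ≡ truth i s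
    litAt-truth i 0F = refl
    litAt-truth i 1F = refl
    litAt-truth i 2F = refl

    assign : Job' n m → Mach' n m
    assign (TJob j)   = TMach j (side (a j))
    assign (CJob i s) = CMach i (cjobSlot (isOneInThree {m} i) (truth i) s)
    assign (VJob j t) = vjobMachine (literalHolds (a j) (signOf t)) j t

    assign-eligible : ∀ J → eligible' κ J (assign J)
    assign-eligible (TJob j)   = refl
    assign-eligible (CJob i s) = refl
    assign-eligible (VJob j t) with literalHolds (a j) (signOf t)
    ... | true  = inj₂ refl
    ... | false = inj₁ refl

    schedule : Schedule I
    schedule = record { assign = assign ; eligible = assign-eligible }

    vjob-on-TMach : ∀ b j t q → 𝟙 (vjobMachine b j t ≟Mach' TMach j q) 1 ≡ (if b then 0 else 𝟙 (half t ≟ᶠ q) 1)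
    vjob-on-TMach true  j t q = refl
    vjob-on-TMach false j t q = 𝟙-TMach j (half t) q

    vjob-off-TMach : ∀ b {j j'} t q → j' ≢ j → vjobMachine b j' t ≢ TMach j q
    vjob-off-TMach true  t q j'≢j ()
    vjob-off-TMach false t q j'≢j refl = j'≢j refl

    load-TMach : ∀ j q → load I schedule (TMach j q) ≡ 2
    load-TMach j q = begin
      load I schedule μ
        ≡⟨ load-split schedule μ ⟩
      loadᵀ assign μ + (loadᶜ assign μ + loadⱽ assign μ)
        ≡⟨ cong₂ _+_ loadᵀ≡ (cong₂ _+_ loadᶜ≡ loadⱽ≡) ⟩
      𝟙 (side (a j) ≟ᶠ q) 2 + (0 + ∑[ t < 4 ] (if literalHolds (a j) (signOf t) then 0 else 𝟙 (half t ≟ᶠ q) 1))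
        ≡⟨ variable-load (a j) q ⟩
      2 ∎
      where
      open ≡-Reasoning
      μ = TMach j q
      loadᵀ≡ : loadᵀ assign μ ≡ 𝟙 (side (a j) ≟ᶠ q) 2
      loadᵀ≡ = trans (∑-single _ j (λ j' j'≢j → 𝟙-no (assign (TJob j') ≟Mach' μ) λ { refl → j'≢j refl }))
                     (𝟙-TMach j (side (a j)) q)
      loadᶜ≡ : loadᶜ assign μ ≡ 0
      loadᶜ≡ = trans (∑₂-const {m + m} {3} 0) (*-zeroʳ (m + m))
      loadⱽ≡ : loadⱽ assign μ ≡ ∑[ t < 4 ] (if literalHolds (a j) (signOf t) then 0 else 𝟙 (half t ≟ᶠ q) 1)
      loadⱽ≡ = trans (∑₂-row _ j λ j' t j'≢j → 𝟙-no (assign (VJob j' t) ≟Mach' μ) {1} (vjob-off-TMach _ t q j'≢j))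
                     (sum-cong-≗ (λ t → vjob-on-TMach (literalHolds (a j) (signOf t)) j t q))

    vjob-on-CMach : ∀ b j t i s' → 𝟙 (vjobMachine b j t ≟Mach' CMach i s') 1 ≤ bit b
    vjob-on-CMach true  j t i s' = 𝟙-≤ (clauseMachine j t ≟Mach' CMach i s')
    vjob-on-CMach false j t i s' = z≤n

    vjob-off-CMach : ∀ b {j t i s'} → κ̂ (j , t) ≢ (i , s') → vjobMachine b j t ≢ CMach i s'
    vjob-off-CMach true  κ̂≢ refl = κ̂≢ refl
    vjob-off-CMach false κ̂≢ ()

    load-CMach : ∀ i s' → load I schedule (CMach i s') ≤ 2
    load-CMach i s' = begin
      load I schedule μ
        ≡⟨ load-split schedule μ ⟩
      loadᵀ assign μ + (loadᶜ assign μ + loadⱽ assign μ)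
        ≤⟨ +-mono-≤ (≤-reflexive loadᵀ≡) (+-mono-≤ (≤-reflexive loadᶜ≡) loadⱽ≤) ⟩
      0 + (∑[ s < 3 ] 𝟙 (cjobSlot b (truth i) s ≟ᶠ s') (cjobSize b s) + bit (truth i s'))
        ≡⟨ clause-load b _ _ _ (sat i) s' ⟩
      2 ∎
      where
      open ≤-Reasoning
      μ = CMach i s'
      b = isOneInThree {m} i
      loadᵀ≡ : loadᵀ assign μ ≡ 0
      loadᵀ≡ = sum-replicate-zero n
      loadᶜ≡ : loadᶜ assign μ ≡ ∑[ s < 3 ] 𝟙 (cjobSlot b (truth i) s ≟ᶠ s') (cjobSize b s)
      loadᶜ≡ = trans (∑₂-row _ i λ i' s i'≢i →
                       𝟙-no (assign (CJob i' s) ≟Mach' μ) {size' {n} {m} (CJob i' s)} λ { refl → i'≢i refl })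
        (sum-cong-≗ λ s → trans (𝟙-CMach i (cjobSlot b (truth i) s) s')
                                (cong (𝟙 (cjobSlot b (truth i) s ≟ᶠ s')) (size'-CJob i s)))
      loadⱽ≤ : loadⱽ assign μ ≤ bit (truth i s')
      loadⱽ≤ with κ̂-surjective (i , s')
      ... | (j , t) , κ̂≡ = begin
        loadⱽ assign μ
          ≡⟨ ∑₂-single _ (j , t) (λ p p≢ → 𝟙-no (assign (uncurry VJob p) ≟Mach' μ) {1}
               (vjob-off-CMach _ λ e → p≢ (κ̂-injective (trans e (sym κ̂≡))))) ⟩
        contribution assign μ (VJob j t)
          ≤⟨ vjob-on-CMach _ j t i s' ⟩
        bit (literalHolds (a j) (signOf t))
          ≡⟨ cong bit (litValue-literalHolds a j (signOf t)) ⟨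
        bit (litValue a (j , signOf t))
          ≡⟨ cong (bit ∘ litValue a) (trans (sym (κ̂-lit j t)) (cong litAt κ̂≡)) ⟩
        bit (litValue a (litAt (i , s')))
          ≡⟨ cong bit (litAt-truth i s') ⟩
        bit (truth i s') ∎

    makespan : MakespanAtMost I schedule 2
    makespan (TMach j q)  = ≤-reflexive (load-TMach j q)
    makespan (CMach i s') = load-CMach i s'

  module FromSchedule (σ : Schedule I) (makespan≤2 : MakespanAtMost I σ 2) where

    open Schedule σ

    side-of : ∀ j → Σ (Fin 2) λ q → assign (TJob j) ≡ TMach j q
    side-of j with assign (TJob j) | eligible (TJob j)
    ... | TMach _ q | refl = q , refl

    a : Fin n → Bool
    a j = does (proj₁ (side-of j) ≟ᶠ 0F)

    true-literal-beside-TJob : ∀ j t → litValue a (j , signOf t) ≡ true → assign (TJob j) ≡ TMach j (half t)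
    true-literal-beside-TJob j t holds = trans (proj₂ (side-of j))
      (cong (TMach j) (holds⇒side≡half _ t (trans (sym (litValue-literalHolds a j (signOf t))) holds)))

    true-literal-on-clause : ∀ j t → litValue a (j , signOf t) ≡ true → assign (VJob j t) ≡ clauseMachine j t
    true-literal-on-clause j t holds with eligible (VJob j t)
    ... | inj₂ onClause   = onClause
    ... | inj₁ onVariable = ⊥-elim (<-irrefl refl (≤-trans 3≤load (makespan≤2 μ)))
      where
      μ = TMach j (half t)
      3≤load : 3 ≤ load I σ μ
      3≤load = begin
        3
          ≡⟨ cong₂ _+_ (𝟙-yes (assign (TJob j) ≟Mach' μ) (true-literal-beside-TJob j t holds))
                       (𝟙-yes (assign (VJob j t) ≟Mach' μ) onVariable) ⟨
        contribution assign μ (TJob j) + contribution assign μ (VJob j t)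
          ≤⟨ +-mono-≤ (∑-≥ (contribution assign μ ∘ TJob) j)
                      (∑₂-≥ (contribution assign μ ∘ uncurry VJob) (j , t)) ⟩
        loadᵀ assign μ + loadⱽ assign μ
          ≤⟨ loadᵀ+loadⱽ≤load σ μ ⟩
        load I σ μ
          ∎
        where open ≤-Reasoning

    truth-≤-loadⱽ : ∀ i s' → bit (litValue a (litAt (i , s'))) ≤ loadⱽ assign (CMach i s')
    truth-≤-loadⱽ i s' with κ̂-surjective (i , s')
    ... | (j , t) , κ̂≡ = begin
      bit (litValue a (litAt (i , s')))  ≡⟨ cong (bit ∘ litValue a) (trans (cong litAt (sym κ̂≡)) (κ̂-lit j t)) ⟩
      bit (litValue a (j , signOf t))    ≤⟨ bit-≤-contribution (litValue a (j , signOf t)) refl ⟩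
      contribution assign μ (VJob j t)   ≤⟨ ∑₂-≥ (contribution assign μ ∘ uncurry VJob) (j , t) ⟩
      loadⱽ assign μ                     ∎
      where
      open ≤-Reasoning
      μ = CMach i s'
      bit-≤-contribution : ∀ b → litValue a (j , signOf t) ≡ b → bit b ≤ contribution assign μ (VJob j t)
      bit-≤-contribution false _     = z≤n
      bit-≤-contribution true  holds = ≤-reflexive (sym (𝟙-yes (assign (VJob j t) ≟Mach' μ)
        (trans (true-literal-on-clause j t holds) (cong (uncurry CMach) κ̂≡))))

    cjob-lands-once : ∀ i s c → ∑[ s' < 3 ] 𝟙 (assign (CJob i s) ≟Mach' CMach i s') c ≡ c
    cjob-lands-once i s c with assign (CJob i s) | eligible (CJob i s)
    ... | CMach _ s'' | refl =
      trans (∑-single (λ s' → 𝟙 (CMach i s'' ≟Mach' CMach i s') c) s''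
                      (λ s' s'≢s'' → 𝟙-no (CMach {n} {m} i s'' ≟Mach' CMach i s') {c} λ { refl → s'≢s'' refl }))
            (𝟙-yes (CMach {n} {m} i s'' ≟Mach' CMach i s'') refl)

    clause-bound : ∀ i → numTrue C a i ≤ target i
    clause-bound i = capacity-left b (numTrue C a i) (begin
      ∑[ s < 3 ] cjobSize b s + numTrue C a i                     ≡⟨ cong (_+ numTrue C a i) cjobs≡ ⟨
      ∑[ s' < 3 ] cjobs s' + ∑[ s' < 3 ] truthAt s'              ≡⟨ ∑-distrib-+ cjobs truthAt ⟨
      ∑[ s' < 3 ] (cjobs s' + truthAt s')                         ≤⟨ ∑-mono-≤ machine≤2 ⟩
      6                                                           ∎)
      where
      open ≤-Reasoning
      b = isOneInThree {m} i
      cjobs truthAt : Fin 3 → ℕ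
      cjobs s' = ∑[ s < 3 ] contribution assign (CMach i s') (CJob i s)
      truthAt s' = bit (litValue a (litAt (i , s')))
      cjobs≡ : ∑ cjobs ≡ ∑[ s < 3 ] cjobSize b s
      cjobs≡ = trans (∑-comm (λ s' s → contribution assign (CMach i s') (CJob i s)))
                     (sum-cong-≗ (λ s → trans (cjob-lands-once i s _) (size'-CJob i s)))
      machine≤2 : ∀ s' → cjobs s' + truthAt s' ≤ 2
      machine≤2 s' = begin
        cjobs s' + truthAt s'
          ≤⟨ +-mono-≤ (∑-≥ (λ i' → ∑[ s < 3 ] contribution assign μ (CJob i' s)) i) (truth-≤-loadⱽ i s') ⟩
        loadᶜ assign μ + loadⱽ assign μ
          ≤⟨ loadᶜ+loadⱽ≤load σ μ ⟩
        load I σ μ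
          ≤⟨ makespan≤2 μ ⟩
        2 ∎
        where μ = CMach i s'

    satisfies : Satisfies C a
    satisfies = ∑-≤-≡⇒≗ clause-bound (begin
      ∑ (numTrue C a)  ≡⟨ true-count a ⟩
      n * 2            ≡⟨ clause-count ⟨
      m * 3            ≡⟨ ∑-target ⟨
      ∑ target         ∎)
      where open ≡-Reasoning

  satisfiable⇔schedulable : Satisfiable C ⇔ Σ (Schedule I) (λ σ → MakespanAtMost I σ 2)
  satisfiable⇔schedulable = mk⇔
    (λ (a , sat) → FromAssignment.schedule a sat , FromAssignment.makespan a sat)
    (λ (σ , makespan≤2) → FromSchedule.a σ makespan≤2 , FromSchedule.satisfies σ makespan≤2)

lemma9 : (n m : ℕ) (C : Clauses n m) → Is3SAT* C →
         (κ : Fin n → Fin 4 → Position m) → IsKappa C κ →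
         Satisfiable C ⇔ Σ (Schedule (reduction n m κ)) (λ σ → MakespanAtMost (reduction n m κ) σ 2)
lemma9 n m C is3 κ isK = Reduction.satisfiable⇔schedulable n m C is3 κ isK
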